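{- $\mathsf{FOR}$ does not express Epstein relations; that is, it is not the case that for all $\varphi,\psi\in\mathsf{FOR}$ there is $\chi\in\mathsf{FOR}$ such that for every $\mathfrak{R}\subseteq\mathsf{FOR}^2$: $\langle\varphi,\psi\rangle\in\mathfrak{R}$ iff $\mathfrak{R}\vDash\chi$.
   Context: Let $\Phi=\{p_0,p_1,\dots\}$ be a countably infinite set of propositional letters; $\mathsf{FOR}$ is the set of formulas built from $\Phi$ with $\neg$ and binary $\lor,\wedge,\to,\leftrightarrow,\vartriangle,\looparrowright$. An Epstein relation is any $\mathfrak{R}\subseteq\mathsf{FOR}^2$; an Epstein model is $\langle v,\mathfrak{R}\rangle$ with $v:\Phi\to\{0,1\}$. Truth: $\langle v,\mathfrak{R}\rangle\vDash p$ iff $v(p)=1$; classical clauses for $\neg,\wedge,\lor,\to,\leftrightarrow$; $\vDash\psi\vartriangle\chi$ iff both $\psi,\chi$ true and $\langle\psi,\chi\rangle\in\mathfrak{R}$; $\vDash\psi\looparrowright\chi$ iff ($\psi$ false or $\chi$ true) and $\langle\psi,\chi\rangle\in\mathfrak{R}$. $\mathfrak{R}\vDash\chi$ iff $\langle v,\mathfrak{R}\rangle\vDash\chi$ for every valuation $v$. -}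

module Defs where

open import Data.Nat using (ℕ)
open import Data.Bool using (Bool; true; false; not; _∧_; _∨_)
open import Relation.Binary.PropositionalEquality using (_≡_)

data FOR : Set where
  var  : ℕ → FOR
  ¬'_  : FOR → FOR
  _∨'_ _∧'_ _⇒'_ _⇔'_ _△_ _↬_ : FOR → FOR → FOR

Valuation : Set
Valuation = ℕ → Bool

EpsteinRelation : Set
EpsteinRelation = FOR → FOR → Bool

_⇒ᵇ_ : Bool → Bool → Bool
a ⇒ᵇ b = not a ∨ b

_⇔ᵇ_ : Bool → Bool → Bool
a ⇔ᵇ b = (a ⇒ᵇ b) ∧ (b ⇒ᵇ a)

⟦_⟧ : FOR → Valuation → EpsteinRelation → Bool
⟦ var i ⟧   v R = v i
⟦ ¬' φ ⟧    v R = not (⟦ φ ⟧ v R)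
⟦ φ ∨' ψ ⟧  v R = ⟦ φ ⟧ v R ∨ ⟦ ψ ⟧ v R
⟦ φ ∧' ψ ⟧  v R = ⟦ φ ⟧ v R ∧ ⟦ ψ ⟧ v R
⟦ φ ⇒' ψ ⟧  v R = ⟦ φ ⟧ v R ⇒ᵇ ⟦ ψ ⟧ v R
⟦ φ ⇔' ψ ⟧  v R = ⟦ φ ⟧ v R ⇔ᵇ ⟦ ψ ⟧ v R
⟦ φ △ ψ ⟧   v R = (⟦ φ ⟧ v R ∧ ⟦ ψ ⟧ v R) ∧ R φ ψ
⟦ φ ↬ ψ ⟧   v R = (not (⟦ φ ⟧ v R) ∨ ⟦ ψ ⟧ v R) ∧ R φ ψ

_,_⊨_ : Valuation → EpsteinRelation → FOR → Set
v , R ⊨ χ = ⟦ χ ⟧ v R ≡ true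

_⊨_ : EpsteinRelation → FOR → Set
R ⊨ χ = ∀ (v : Valuation) → v , R ⊨ χ

_∈ℜ_ : FOR → FOR → EpsteinRelation → Set
(φ ∈ℜ ψ) R = R φ ψ ≡ true

-- If φ is valid and ψ unsatisfiable, then φ △ ψ and φ ↬ ψ are false under every
-- valuation whether or not ⟨φ,ψ⟩ ∈ ℜ.  Hence adding or removing such a pair never
-- changes the truth value of any formula, and no χ can express ⟨p₀ ∨ ¬p₀ , p₀ ∧ ¬p₀⟩ ∈ ℜ.
module Submission where

open import Defs
open import Data.Bool using (true; false; not; _∧_; _∨_)
open import Data.Bool.Properties using (∧-zeroʳ)
open import Data.Maybe using (Maybe; just; nothing)
open import Data.Nat using (zero)
open import Data.Product using (Σ; _×_; _,_)
open import Data.Sum using (_⊎_; inj₁; inj₂)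
open import Function.Bundles using (_⇔_; Equivalence)
open import Relation.Binary.PropositionalEquality using (_≡_; refl; sym; trans; cong; cong₂)
open import Relation.Nullary using (¬_)

ValidAndUnsat : EpsteinRelation → FOR → FOR → Set
ValidAndUnsat R φ ψ = ∀ v → ⟦ φ ⟧ v R ≡ true × ⟦ ψ ⟧ v R ≡ false

∧-false-∧ : ∀ {a b} r → b ≡ false → (a ∧ b) ∧ r ≡ false
∧-false-∧ {a} r refl rewrite ∧-zeroʳ a = refl

⇒-true-false-∧ : ∀ {a b} r → a ≡ true → b ≡ false → (not a ∨ b) ∧ r ≡ false
⇒-true-false-∧ r refl refl = refl

⟦⟧-cong-modulo-ValidAndUnsat : (R R′ : EpsteinRelation) →
  (∀ φ ψ → R φ ψ ≡ R′ φ ψ ⊎ ValidAndUnsat R φ ψ) →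
  ∀ χ v → ⟦ χ ⟧ v R ≡ ⟦ χ ⟧ v R′
⟦⟧-cong-modulo-ValidAndUnsat R R′ differ = go
  where
  go : ∀ χ v → ⟦ χ ⟧ v R ≡ ⟦ χ ⟧ v R′
  go (var i)  v = refl
  go (¬' φ)   v = cong not (go φ v)
  go (φ ∨' ψ) v = cong₂ _∨_ (go φ v) (go ψ v)
  go (φ ∧' ψ) v = cong₂ _∧_ (go φ v) (go ψ v)
  go (φ ⇒' ψ) v = cong₂ _⇒ᵇ_ (go φ v) (go ψ v)
  go (φ ⇔' ψ) v = cong₂ _⇔ᵇ_ (go φ v) (go ψ v)
  go (φ △ ψ)  v with differ φ ψ
  ... | inj₁ same = cong₂ _∧_ (cong₂ _∧_ (go φ v) (go ψ v)) same
  ... | inj₂ inert =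
    let (_ , ψ-false) = inert v in
    trans (∧-false-∧ (R φ ψ) ψ-false)
          (sym (∧-false-∧ (R′ φ ψ) (trans (sym (go ψ v)) ψ-false)))
  go (φ ↬ ψ)  v with differ φ ψ
  ... | inj₁ same = cong₂ _∧_ (cong₂ _∨_ (cong not (go φ v)) (go ψ v)) same
  ... | inj₂ inert =
    let (φ-true , ψ-false) = inert v in
    trans (⇒-true-false-∧ (R φ ψ) φ-true ψ-false)
          (sym (⇒-true-false-∧ (R′ φ ψ) (trans (sym (go φ v)) φ-true)
                                        (trans (sym (go ψ v)) ψ-false)))

⊤₀ ⊥₀ : FOR
⊤₀ = var zero ∨' (¬' var zero)
⊥₀ = var zero ∧' (¬' var zero)

full : EpsteinRelation
full _ _ = true

≟⊤₀ : (φ : FOR) → Maybe (φ ≡ ⊤₀)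
≟⊤₀ (var zero ∨' (¬' var zero)) = just refl
≟⊤₀ _                           = nothing

≟⊥₀ : (ψ : FOR) → Maybe (ψ ≡ ⊥₀)
≟⊥₀ (var zero ∧' (¬' var zero)) = just refl
≟⊥₀ _                           = nothing

full-without-⊤₀⊥₀ : EpsteinRelation
full-without-⊤₀⊥₀ φ ψ with ≟⊤₀ φ | ≟⊥₀ ψ
... | just _ | just _ = false
... | _      | _      = true

⊤₀⊥₀-ValidAndUnsat : ValidAndUnsat full ⊤₀ ⊥₀
⊤₀⊥₀-ValidAndUnsat v with v zero
... | true  = refl , refl
... | false = refl , refl

full≡without-⊤₀⊥₀-modulo-ValidAndUnsat : ∀ φ ψ →
  full φ ψ ≡ full-without-⊤₀⊥₀ φ ψ ⊎ ValidAndUnsat full φ ψ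
full≡without-⊤₀⊥₀-modulo-ValidAndUnsat φ ψ with ≟⊤₀ φ | ≟⊥₀ ψ
... | just refl | just refl = inj₂ ⊤₀⊥₀-ValidAndUnsat
... | just _    | nothing   = inj₁ refl
... | nothing   | _         = inj₁ refl

mainTheorem15 : ¬ (∀ (φ ψ : FOR) → Σ FOR (λ χ →
                    ∀ (R : EpsteinRelation) → ((φ ∈ℜ ψ) R ⇔ R ⊨ χ)))
mainTheorem15 expresses with expresses ⊤₀ ⊥₀
... | χ , χ-expresses = false≢true ⊤₀⊥₀∈without
  where
  full⊨χ : full ⊨ χ
  full⊨χ = Equivalence.to (χ-expresses full) refl

  without⊨χ : full-without-⊤₀⊥₀ ⊨ χ
  without⊨χ v = trans (sym (⟦⟧-cong-modulo-ValidAndUnsat full full-without-⊤₀⊥₀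
                              full≡without-⊤₀⊥₀-modulo-ValidAndUnsat χ v))
                      (full⊨χ v)

  ⊤₀⊥₀∈without : (⊤₀ ∈ℜ ⊥₀) full-without-⊤₀⊥₀
  ⊤₀⊥₀∈without = Equivalence.from (χ-expresses full-without-⊤₀⊥₀) without⊨χ

  false≢true : ¬ false ≡ true
  false≢true ()
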